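{- Let $S$ be an $h$-dimensional $\mathbb{F}_q$-subspace of $\mathbb{F}_{q^n}$ such that $1\in S$ and $h\le n-2$. Let $(a,b)\in\mathbb{F}_{q^n}^2$ with $a\notin S$ and $b\notin\mathbb{F}_q$, and let $U=(S\times\{0\})+\langle(1,1)\rangle_{\mathbb{F}_q}+\langle(a,b)\rangle_{\mathbb{F}_q}\subseteq\mathbb{F}_{q^n}^2$. Then $L_U=\{\langle(s+\alpha+\beta a,\alpha+\beta b)\rangle_{\mathbb{F}_{q^n}} : s\in S,\ \alpha,\beta\in\mathbb{F}_q,\ (s,\alpha,\beta)\neq(0,0,0)\}$ is an $\mathbb{F}_q$-linear set of rank $h+2$ in $\mathrm{PG}(1,q^n)$, with $w_{L_U}(\langle(1,0)\rangle_{\mathbb{F}_{q^n}})=h$ and $w_{L_U}(\langle(0,1)\rangle_{\mathbb{F}_{q^n}})=1$.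
   Context: $q$ is a prime power and $n$ a positive integer. For an $\mathbb{F}_q$-subspace $U$ of $\mathbb{F}_{q^n}^2$, the $\mathbb{F}_q$-linear set $L_U=\{\langle u\rangle_{\mathbb{F}_{q^n}} : u\in U\setminus\{0\}\}\subseteq\mathrm{PG}(1,q^n)$ has rank $\dim_{\mathbb{F}_q}(U)$. The weight of a point $P=\langle v\rangle_{\mathbb{F}_{q^n}}$ is $w_{L_U}(P)=\dim_{\mathbb{F}_q}(U\cap\langle v\rangle_{\mathbb{F}_{q^n}})$. -}

module Defs where

open import Level using (0ℓ)
open import Algebra.Bundles using (CommutativeRing)
open import Data.Nat using (ℕ; zero; suc; _^_)
open import Data.Nat.Primality using (Prime)
open import Data.Fin using (Fin; zero; suc)
open import Data.List using (List; length)
open import Data.List.Membership.Setoid using ()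
open import Data.Product using (Σ; ∃; ∃-syntax; _×_; _,_)
open import Data.Unit using (⊤)
open import Relation.Nullary using (¬_)
open import Relation.Binary.PropositionalEquality using (_≡_)

IsPrimePower : ℕ → Set
IsPrimePower q = Σ ℕ λ p → Σ ℕ λ k → Prime p × q ≡ p ^ suc k

record IsField (K : CommutativeRing 0ℓ 0ℓ) : Set where
  open CommutativeRing K using (Carrier; _≈_; _+_; _*_; -_; 0#; 1#)
  field
    1≉0 : ¬ (1# ≈ 0#)
    inv : ∀ x → ¬ (x ≈ 0#) → Σ Carrier λ y → x * y ≈ 1#

module Over (K : CommutativeRing 0ℓ 0ℓ) where
  open CommutativeRing K using (Carrier; _≈_; _+_; _*_; -_; 0#; 1#)

  record IsSubfield (F : Carrier → Set) : Set where
    field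
      resp : ∀ {x y} → x ≈ y → F x → F y
      has0 : F 0#
      has1 : F 1#
      +-closed : ∀ {x y} → F x → F y → F (x + y)
      neg-closed : ∀ {x} → F x → F (- x)
      *-closed : ∀ {x y} → F x → F y → F (x * y)
      inv-closed : ∀ {x y} → F x → x * y ≈ 1# → F y

  HasSize : (Carrier → Set) → ℕ → Set
  HasSize F q = Σ (Fin q → Carrier) λ e →
      (∀ i → F (e i))
    × (∀ i j → e i ≈ e j → i ≡ j)
    × (∀ x → F x → ∃[ i ] (x ≈ e i))

  -- A vector space over K (we only use scalar multiplication by elements of F)
  record KSpace : Set₁ where
    field
      V : Set
      _≈ᵥ_ : V → V → Set
      _+ᵥ_ : V → V → V
      0ᵥ : V
      _·_ : Carrier → V → V

  module InSpace (E : KSpace) (F : Carrier → Set) where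
    open KSpace E

    lc : (d : ℕ) → (Fin d → Carrier) → (Fin d → V) → V
    lc zero c v = 0ᵥ
    lc (suc d) c v = (c zero · v zero) +ᵥ lc d (λ i → c (suc i)) (λ i → v (suc i))

    FCoeffs : (d : ℕ) → (Fin d → Carrier) → Set
    FCoeffs d c = ∀ i → F (c i)

    record IsFSubspace (W : V → Set) : Set where
      field
        resp : ∀ {x y} → x ≈ᵥ y → W x → W y
        has0 : W 0ᵥ
        +-closed : ∀ {x y} → W x → W y → W (x +ᵥ y)
        ·-closed : ∀ {c x} → F c → W x → W (c · x)

    record IsFBasis (W : V → Set) (d : ℕ) (v : Fin d → V) : Set where
      field
        inW : ∀ i → W (v i)
        independent : ∀ c → FCoeffs d c → lc d c v ≈ᵥ 0ᵥ → ∀ i → c i ≈ 0#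
        spanning : ∀ w → W w → Σ (Fin d → Carrier) λ c → FCoeffs d c × (w ≈ᵥ lc d c v)

    FDim : (V → Set) → ℕ → Set
    FDim W d = Σ (Fin d → V) (IsFBasis W d)

  K¹ : KSpace
  K¹ = record { V = Carrier ; _≈ᵥ_ = _≈_ ; _+ᵥ_ = _+_ ; 0ᵥ = 0# ; _·_ = _*_ }

  K² : KSpace
  K² = record
    { V = Carrier × Carrier
    ; _≈ᵥ_ = λ { (x₁ , x₂) (y₁ , y₂) → (x₁ ≈ y₁) × (x₂ ≈ y₂) }
    ; _+ᵥ_ = λ { (x₁ , x₂) (y₁ , y₂) → (x₁ + y₁ , x₂ + y₂) }
    ; 0ᵥ = (0# , 0#)
    ; _·_ = λ { c (x₁ , x₂) → (c * x₁ , c * x₂) }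
    }

  -- the K-span ⟨v⟩_K of a vector of K² (the point ⟨v⟩ of PG(1,K) as a subspace)
  KSpan : Carrier × Carrier → Carrier × Carrier → Set
  KSpan (v₁ , v₂) (w₁ , w₂) = Σ Carrier λ λ' → (w₁ ≈ λ' * v₁) × (w₂ ≈ λ' * v₂)

  -- weight of the point ⟨v⟩_K in L_U: dim_F (U ∩ ⟨v⟩_K) = d
  Weight : (F : Carrier → Set) → (U : Carrier × Carrier → Set) → Carrier × Carrier → ℕ → Set
  Weight F U v d = InSpace.FDim K² F (λ w → U w × KSpan v w) d

  Rank : (F : Carrier → Set) → (U : Carrier × Carrier → Set) → ℕ → Set
  Rank F U d = InSpace.FDim K² F U d

  UOf : (F S : Carrier → Set) → Carrier → Carrier → Carrier × Carrier → Set
  UOf F S a b (w₁ , w₂) = Σ Carrier λ s → Σ Carrier λ α → Σ Carrier λ β →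
    S s × F α × F β × (w₁ ≈ s + α + β * a) × (w₂ ≈ α + β * b)

{-# OPTIONS --safe #-}
-- A relation s + α + β a = 0 (resp. α + β b = 0)
-- with β ≠ 0 would put a in S (resp. b in F_q), so in every vanishing combination the
-- coefficients of (a,b) and of (1,1) are zero; the basis of S then finishes each claim.
-- Over the finite field F_q "β = 0 or β ≠ 0" is decidable, which makes the argument constructive.
module Submission where

open import Defs
open import Level using (0ℓ)
open import Algebra.Bundles using (CommutativeRing)
open import Data.Nat using (ℕ; zero; suc)
open import Data.Fin using (Fin; zero; suc; _≟_)
open import Data.Vec.Functional using (_∷_; tail)
open import Data.Product using (Σ; _×_; _,_; proj₁; proj₂)
open import Data.Unit using (⊤)
open import Data.Empty using (⊥-elim)
open import Relation.Nullary using (¬_; Dec; yes; no)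
import Relation.Binary.PropositionalEquality as ≡
open Over

module _ (K : CommutativeRing 0ℓ 0ℓ) (F : CommutativeRing.Carrier K → Set) where
  open CommutativeRing K hiding (zero)
  open import Algebra.Properties.Ring ring using (-1*x≈-x)
  open import Algebra.Properties.Group +-group using (inverseʳ-unique)
  open import Relation.Binary.Reasoning.Setoid setoid

  HasSize⇒≈-dec : ∀ {q} → HasSize K F q → ∀ {x y} → F x → F y → Dec (x ≈ y)
  HasSize⇒≈-dec (enum , _ , enum-injective , enum-surjective) Fx Fy
    with enum-surjective _ Fx | enum-surjective _ Fy
  ... | i , x≈eᵢ | j , y≈eⱼ with i ≟ j
  ...   | yes ≡.refl = yes (trans x≈eᵢ (sym y≈eⱼ))
  ...   | no i≢j = no λ x≈y → i≢j (enum-injective i j (trans (sym x≈eᵢ) (trans x≈y y≈eⱼ)))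

  IsSubfield⇒IsFSubspace : IsSubfield K F → InSpace.IsFSubspace K (K¹ K) F F
  IsSubfield⇒IsFSubspace subfield = record
    { resp = resp ; has0 = has0 ; +-closed = +-closed ; ·-closed = *-closed }
    where open IsSubfield subfield

  module _ (subfield : IsSubfield K F) {W : Carrier → Set}
           (W-subspace : InSpace.IsFSubspace K (K¹ K) F W) where
    private
      module F = IsSubfield subfield
      module W = InSpace.IsFSubspace W-subspace

    IsFSubspace-neg-closed : ∀ {x} → W x → W (- x)
    IsFSubspace-neg-closed Wx = W.resp (-1*x≈-x _) (W.·-closed (F.neg-closed F.has1) Wx)

    1∈W⇒F⊆W : W 1# → ∀ {x} → F x → W x
    1∈W⇒F⊆W W1 Fx = W.resp (*-identityʳ _) (W.·-closed Fx W1)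

    ∉-subspace⇒coefficient≈0 : IsField K → (∀ {x} → F x → Dec (x ≈ 0#)) →
      ∀ {t w β} → ¬ W t → W w → F β → w + β * t ≈ 0# → β ≈ 0#
    ∉-subspace⇒coefficient≈0 isField F-dec0 {t} {w} {β} t∉W Ww Fβ w+βt≈0
      with F-dec0 Fβ
    ... | yes β≈0 = β≈0
    ... | no β≉0 with IsField.inv isField β β≉0
    ...   | β⁻¹ , ββ⁻¹≈1 =
      ⊥-elim (t∉W (W.resp (sym t≈β⁻¹[-w])
        (W.·-closed (F.inv-closed Fβ ββ⁻¹≈1) (IsFSubspace-neg-closed Ww))))
      where
      t≈β⁻¹[-w] : t ≈ β⁻¹ * (- w)
      t≈β⁻¹[-w] = begin
        t                ≈⟨ *-identityˡ t ⟨
        1# * t           ≈⟨ *-congʳ ββ⁻¹≈1 ⟨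
        β * β⁻¹ * t      ≈⟨ *-congʳ (*-comm β β⁻¹) ⟩
        β⁻¹ * β * t      ≈⟨ *-assoc β⁻¹ β t ⟩
        β⁻¹ * (β * t)    ≈⟨ *-congˡ (inverseʳ-unique w (β * t) w+βt≈0) ⟩
        β⁻¹ * (- w)      ∎

  private
    lc¹ = InSpace.lc K (K¹ K) F
    lc² = InSpace.lc K (K² K) F

  lc²-proj₁ : ∀ d c (u v : Fin d → Carrier) → proj₁ (lc² d c (λ i → u i , v i)) ≈ lc¹ d c u
  lc²-proj₁ zero    c u v = refl
  lc²-proj₁ (suc d) c u v = +-congˡ (lc²-proj₁ d (λ i → c (suc i)) (λ i → u (suc i)) (λ i → v (suc i)))

  lc²-proj₂ : ∀ d c (u v : Fin d → Carrier) → proj₂ (lc² d c (λ i → u i , v i)) ≈ lc¹ d c v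
  lc²-proj₂ zero    c u v = refl
  lc²-proj₂ (suc d) c u v = +-congˡ (lc²-proj₂ d (λ i → c (suc i)) (λ i → u (suc i)) (λ i → v (suc i)))

  lc¹-zero : ∀ d c → lc¹ d c (λ _ → 0#) ≈ 0#
  lc¹-zero zero    c = refl
  lc¹-zero (suc d) c = trans (+-cong (zeroʳ (c zero)) (lc¹-zero d (λ i → c (suc i)))) (+-identityʳ 0#)

  x+0*y≈x : ∀ x y → x + 0# * y ≈ x
  x+0*y≈x x y = trans (+-congˡ (zeroˡ y)) (+-identityʳ x)

  module Construction (isField : IsField K) (subfield : IsSubfield K F)
           (F-dec0 : ∀ {x} → F x → Dec (x ≈ 0#))
           {S : Carrier → Set} (S-subspace : InSpace.IsFSubspace K (K¹ K) F S) (1∈S : S 1#)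
           {h : ℕ} {e : Fin h → Carrier} (e-basis : InSpace.IsFBasis K (K¹ K) F S h e)
           {a b : Carrier} (a∉S : ¬ S a) (b∉F : ¬ F b) where
    private
      module F = IsSubfield subfield
      module S = InSpace.IsFSubspace S-subspace
      module e = InSpace.IsFBasis e-basis
      U = UOf K F S a b
      IsFBasis² = InSpace.IsFBasis K (K² K) F

    α+βb≈0⇒α≈0×β≈0 : ∀ {α β} → F α → F β → α + β * b ≈ 0# → α ≈ 0# × β ≈ 0#
    α+βb≈0⇒α≈0×β≈0 {α} {β} Fα Fβ α+βb≈0 = α≈0 , β≈0
      where
      β≈0 : β ≈ 0#
      β≈0 = ∉-subspace⇒coefficient≈0 subfield (IsSubfield⇒IsFSubspace subfield)
              isField F-dec0 b∉F Fα Fβ α+βb≈0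
      α≈0 : α ≈ 0#
      α≈0 = begin
        α            ≈⟨ x+0*y≈x α b ⟨
        α + 0# * b   ≈⟨ +-congˡ (*-congʳ β≈0) ⟨
        α + β * b    ≈⟨ α+βb≈0 ⟩
        0#           ∎

    s+α+βa≈0⇒β≈0 : ∀ {s α β} → S s → F α → F β → s + α + β * a ≈ 0# → β ≈ 0#
    s+α+βa≈0⇒β≈0 Ss Fα Fβ =
      ∉-subspace⇒coefficient≈0 subfield S-subspace isField F-dec0 a∉S
        (S.+-closed Ss (1∈W⇒F⊆W subfield S-subspace 1∈S Fα)) Fβ

    S×0⊆U : ∀ {s} → S s → U (s , 0#)
    S×0⊆U {s} Ss = s , 0# , 0# , Ss , F.has0 , F.has0 ,
      sym (trans (x+0*y≈x (s + 0#) a) (+-identityʳ s)) , sym (x+0*y≈x 0# b)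

    U∩[K×0]⊆S×0 : ∀ {w₁ w₂} → U (w₁ , w₂) → w₂ ≈ 0# → S w₁
    U∩[K×0]⊆S×0 {w₁} (s , α , β , Ss , Fα , Fβ , w₁≈ , w₂≈) w₂≈0 = S.resp (sym w₁≈s) Ss
      where
      α≈0×β≈0 = α+βb≈0⇒α≈0×β≈0 Fα Fβ (trans (sym w₂≈) w₂≈0)
      w₁≈s : w₁ ≈ s
      w₁≈s = begin
        w₁               ≈⟨ w₁≈ ⟩
        s + α + β * a    ≈⟨ +-cong (+-congˡ (proj₁ α≈0×β≈0)) (*-congʳ (proj₂ α≈0×β≈0)) ⟩
        s + 0# + 0# * a  ≈⟨ x+0*y≈x (s + 0#) a ⟩
        s + 0#           ≈⟨ +-identityʳ s ⟩
        s                ∎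

    U∩[0×K]⊆0×F : ∀ {w₁ w₂} → U (w₁ , w₂) → w₁ ≈ 0# → F w₂
    U∩[0×K]⊆0×F {_} {w₂} (s , α , β , Ss , Fα , Fβ , w₁≈ , w₂≈) w₁≈0 = F.resp (sym w₂≈α) Fα
      where
      w₂≈α : w₂ ≈ α
      w₂≈α = begin
        w₂          ≈⟨ w₂≈ ⟩
        α + β * b   ≈⟨ +-congˡ (*-congʳ (s+α+βa≈0⇒β≈0 Ss Fα Fβ (trans (sym w₁≈) w₁≈0))) ⟩
        α + 0# * b  ≈⟨ x+0*y≈x α b ⟩
        α           ∎

    S×0-basis : Fin h → Carrier × Carrier
    S×0-basis i = e i , 0#

    lc²-S×0-basis : ∀ c → proj₁ (lc² h c S×0-basis) ≈ lc¹ h c e × proj₂ (lc² h c S×0-basis) ≈ 0#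
    lc²-S×0-basis c = lc²-proj₁ h c e (λ _ → 0#) , trans (lc²-proj₂ h c e (λ _ → 0#)) (lc¹-zero h c)

    U∩⟨1,0⟩-basis : IsFBasis² (λ w → U w × KSpan K (1# , 0#) w) h S×0-basis
    U∩⟨1,0⟩-basis = record { inW = inW ; independent = independent ; spanning = spanning }
      where
      inW : ∀ i → U (S×0-basis i) × KSpan K (1# , 0#) (S×0-basis i)
      inW i = S×0⊆U (e.inW i) , e i , sym (*-identityʳ (e i)) , sym (zeroʳ (e i))
      independent : ∀ c → (∀ i → F (c i)) → proj₁ (lc² h c S×0-basis) ≈ 0# × proj₂ (lc² h c S×0-basis) ≈ 0# →
        ∀ i → c i ≈ 0#
      independent c Fc (lc₁≈0 , _) = e.independent c Fc (trans (sym (proj₁ (lc²-S×0-basis c))) lc₁≈0)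
      spanning : ∀ w → U w × KSpan K (1# , 0#) w → Σ (Fin h → Carrier) λ c → (∀ i → F (c i)) ×
        (proj₁ w ≈ proj₁ (lc² h c S×0-basis) × proj₂ w ≈ proj₂ (lc² h c S×0-basis))
      spanning (w₁ , w₂) (Uw , λ' , _ , w₂≈λ'0) =
        let w₂≈0 = trans w₂≈λ'0 (zeroʳ λ')
            (c , Fc , w₁≈lc) = e.spanning w₁ (U∩[K×0]⊆S×0 Uw w₂≈0)
        in c , Fc , trans w₁≈lc (sym (proj₁ (lc²-S×0-basis c))) , trans w₂≈0 (sym (proj₂ (lc²-S×0-basis c)))

    U∩⟨0,1⟩-basis : IsFBasis² (λ w → U w × KSpan K (0# , 1#) w) 1 (λ _ → 0# , 1#)
    U∩⟨0,1⟩-basis = record { inW = inW ; independent = independent ; spanning = spanning }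
      where
      inW : ∀ i → U (0# , 1#) × KSpan K (0# , 1#) (0# , 1#)
      inW _ = (- 1# , 1# , 0# , IsFSubspace-neg-closed subfield S-subspace 1∈S , F.has1 , F.has0 ,
                 sym (trans (x+0*y≈x (- 1# + 1#) a) (-‿inverseˡ 1#)) , sym (x+0*y≈x 1# b)) ,
              1# , sym (zeroʳ 1#) , sym (*-identityʳ 1#)
      independent : ∀ c → (∀ i → F (c i)) → c zero * 0# + 0# ≈ 0# × c zero * 1# + 0# ≈ 0# →
        ∀ i → c i ≈ 0#
      independent c _ (_ , lc₂≈0) zero = trans (sym (trans (+-identityʳ _) (*-identityʳ (c zero)))) lc₂≈0
      spanning : ∀ w → U w × KSpan K (0# , 1#) w → Σ (Fin 1 → Carrier) λ c → (∀ i → F (c i)) ×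
        (proj₁ w ≈ c zero * 0# + 0# × proj₂ w ≈ c zero * 1# + 0#)
      spanning (w₁ , w₂) (Uw , λ' , w₁≈λ'0 , _) =
        let w₁≈0 = trans w₁≈λ'0 (zeroʳ λ')
        in (λ _ → w₂) , (λ _ → U∩[0×K]⊆0×F Uw w₁≈0) ,
           trans w₁≈0 (sym (trans (+-identityʳ _) (zeroʳ w₂))) ,
           sym (trans (+-identityʳ _) (*-identityʳ w₂))

    U-basis : Fin (suc (suc h)) → Carrier × Carrier
    U-basis = (1# , 1#) ∷ (a , b) ∷ S×0-basis

    U-basis-inU : ∀ i → U (U-basis i)
    U-basis-inU zero = 0# , 1# , 0# , S.has0 , F.has1 , F.has0 ,
      sym (trans (x+0*y≈x (0# + 1#) a) (+-identityˡ 1#)) , sym (x+0*y≈x 1# b)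
    U-basis-inU (suc zero) = 0# , 0# , 1# , S.has0 , F.has0 , F.has1 ,
      sym (trans (+-congʳ (+-identityˡ 0#)) (trans (+-identityˡ (1# * a)) (*-identityˡ a))) ,
      sym (trans (+-identityˡ (1# * b)) (*-identityˡ b))
    U-basis-inU (suc (suc i)) = S×0⊆U (e.inW i)

    U-basis-independent : ∀ c → (∀ i → F (c i)) →
      proj₁ (lc² (suc (suc h)) c U-basis) ≈ 0# × proj₂ (lc² (suc (suc h)) c U-basis) ≈ 0# →
      ∀ i → c i ≈ 0#
    U-basis-independent c Fc (lc₁≈0 , lc₂≈0) = coefficients≈0
      where
      cₛ = tail (tail c)
      X₁ = proj₁ (lc² h cₛ S×0-basis)
      α≈0×β≈0 : c zero ≈ 0# × c (suc zero) ≈ 0#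
      α≈0×β≈0 = α+βb≈0⇒α≈0×β≈0 (Fc zero) (Fc (suc zero)) (begin
        c zero + c (suc zero) * b
          ≈⟨ +-cong (*-identityʳ (c zero)) (trans (+-congˡ (proj₂ (lc²-S×0-basis cₛ))) (+-identityʳ _)) ⟨
        proj₂ (lc² (suc (suc h)) c U-basis)
          ≈⟨ lc₂≈0 ⟩
        0# ∎)
      lcₛ≈0 : lc¹ h cₛ e ≈ 0#
      lcₛ≈0 = begin
        lc¹ h cₛ e                              ≈⟨ proj₁ (lc²-S×0-basis cₛ) ⟨
        X₁                                      ≈⟨ trans (+-identityˡ (0# + X₁)) (+-identityˡ X₁) ⟨
        0# + (0# + X₁)                          ≈⟨ +-cong (trans (*-identityʳ _) (proj₁ α≈0×β≈0))
                                                          (+-congʳ (trans (*-congʳ (proj₂ α≈0×β≈0)) (zeroˡ a))) ⟨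
        c zero * 1# + (c (suc zero) * a + X₁)   ≈⟨ lc₁≈0 ⟩
        0#                                      ∎
      coefficients≈0 : ∀ i → c i ≈ 0#
      coefficients≈0 zero          = proj₁ α≈0×β≈0
      coefficients≈0 (suc zero)    = proj₂ α≈0×β≈0
      coefficients≈0 (suc (suc i)) = e.independent cₛ (λ j → Fc (suc (suc j))) lcₛ≈0 i

    U-basis-spanning : ∀ w → U w → Σ (Fin (suc (suc h)) → Carrier) λ c → (∀ i → F (c i)) ×
      (proj₁ w ≈ proj₁ (lc² (suc (suc h)) c U-basis) × proj₂ w ≈ proj₂ (lc² (suc (suc h)) c U-basis))
    U-basis-spanning (w₁ , w₂) (s , α , β , Ss , Fα , Fβ , w₁≈ , w₂≈) with e.spanning s Ss
    ... | cₛ , Fcₛ , s≈lc = α ∷ β ∷ cₛ , coefficients-in-F , w₁≈lc , w₂≈lc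
      where
      coefficients-in-F : ∀ i → F ((α ∷ β ∷ cₛ) i)
      coefficients-in-F zero          = Fα
      coefficients-in-F (suc zero)    = Fβ
      coefficients-in-F (suc (suc i)) = Fcₛ i
      X₁≈s : proj₁ (lc² h cₛ S×0-basis) ≈ s
      X₁≈s = trans (proj₁ (lc²-S×0-basis cₛ)) (sym s≈lc)
      w₁≈lc : w₁ ≈ α * 1# + (β * a + proj₁ (lc² h cₛ S×0-basis))
      w₁≈lc = begin
        w₁                ≈⟨ w₁≈ ⟩
        s + α + β * a     ≈⟨ +-assoc s α (β * a) ⟩
        s + (α + β * a)   ≈⟨ +-comm s (α + β * a) ⟩
        α + β * a + s     ≈⟨ +-assoc α (β * a) s ⟩
        α + (β * a + s)   ≈⟨ +-cong (*-identityʳ α) (+-congˡ X₁≈s) ⟨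
        α * 1# + (β * a + proj₁ (lc² h cₛ S×0-basis)) ∎
      w₂≈lc : w₂ ≈ α * 1# + (β * b + proj₂ (lc² h cₛ S×0-basis))
      w₂≈lc = trans w₂≈ (sym (+-cong (*-identityʳ α)
                (trans (+-congˡ (proj₂ (lc²-S×0-basis cₛ))) (+-identityʳ (β * b)))))

    U-rank : Rank K F U (suc (suc h))
    U-rank = U-basis , record
      { inW = U-basis-inU ; independent = U-basis-independent ; spanning = U-basis-spanning }

open import Data.Nat using (_+_; _∸_; _≤_)
open import Data.Nat.Properties using (+-comm)
open CommutativeRing using (Carrier; 0#; 1#)

proposition3p1 : (q n : ℕ) → IsPrimePower q → (K : CommutativeRing 0ℓ 0ℓ) → IsField K →
    (F : Carrier K → Set) → IsSubfield K F → HasSize K F q →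
    InSpace.FDim K (K¹ K) F (λ _ → ⊤) n →
    (S : Carrier K → Set) → (h : ℕ) →
    InSpace.IsFSubspace K (K¹ K) F S → InSpace.FDim K (K¹ K) F S h →
    S (1# K) → h ≤ n ∸ 2 →
    (a b : Carrier K) → ¬ S a → ¬ F b →
    Rank K F (UOf K F S a b) (h + 2)
    × Weight K F (UOf K F S a b) (1# K , 0# K) h
    × Weight K F (UOf K F S a b) (0# K , 1# K) 1
proposition3p1 _ _ _ K isField F subfield F-finite _ S h S-subspace (e , e-basis) 1∈S _ a b a∉S b∉F =
  ≡.subst (Rank K F (UOf K F S a b)) (+-comm 2 h) U-rank ,
  (S×0-basis , U∩⟨1,0⟩-basis) ,
  ((λ _ → 0# K , 1# K) , U∩⟨0,1⟩-basis)
  where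
  F-dec0 : ∀ {x} → F x → Dec (CommutativeRing._≈_ K x (0# K))
  F-dec0 Fx = HasSize⇒≈-dec K F F-finite Fx (IsSubfield.has0 subfield)
  open Construction K F isField subfield F-dec0 S-subspace 1∈S e-basis a∉S b∉F
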